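{- Let $q$ be a prime power, let $k\in\mathbb{N}$ with $\gcd(k,q)=1$, and let $\zeta_k$ be a generator of the group of $k$-th roots of unity over $\mathbb{F}_q$. Let $f\in\mathbb{F}_q[X]$ be a polynomial of degree $n$ with $f(0)\neq 0$, and set $$t=\max\{m : m\mid \gcd(n,k),\ f(X)=g(X^m)\text{ for some } g\in\mathbb{F}_q[X]\}.$$ Then for $0\le j,j'\le k-1$, the polynomials $\zeta_k^{ -jn}f(\zeta_k^{j}X)$ and $\zeta_k^{ -j'n}f(\zeta_k^{j'}X)$ are equal if and only if $j\equiv j'\pmod{k/t}$.
   Context: The group of $k$-th roots of unity over $\mathbb{F}_q$ is the set of roots of $X^k-1$ in an extension field of $\mathbb{F}_q$; for $\gcd(q,k)=1$ it is cyclic of order $k$. -}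

module Defs where

open import Level using (Level; _⊔_) renaming (suc to lsuc)
open import Relation.Binary.PropositionalEquality using (_≡_)
open import Data.Nat as ℕ using (ℕ; zero; suc; _≤_)
open import Data.Nat.Primality using (Prime)
open import Data.Fin using (Fin)
open import Data.List as List using (List; []; _∷_; replicate; _++_)
open import Data.Product using (Σ; ∃; _×_; _,_)
open import Relation.Nullary using (¬_)
open import Algebra.Bundles using (CommutativeRing)
open import Algebra.Morphism.Structures using (IsRingHomomorphism)

-- A field: a commutative ring with 0 ≠ 1 in which every nonzero element
-- has a multiplicative inverse. (agda-stdlib 2.3 has no Field bundle.)
-- The inverse is a total operation; its value at 0 is unconstrained.
record Field (c ℓ : Level) : Set (lsuc (c ⊔ ℓ)) where
  field
    commutativeRing : CommutativeRing c ℓ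
  open CommutativeRing commutativeRing public
  field
    _⁻¹       : Carrier → Carrier
    0≉1       : ¬ (0# ≈ 1#)
    ⁻¹-inverse : ∀ x → ¬ (x ≈ 0#) → (x * (x ⁻¹)) ≈ 1#

module FieldOps {c ℓ} (K : Field c ℓ) where
  open Field K

  _^_ : Carrier → ℕ → Carrier
  x ^ zero  = 1#
  x ^ suc n = x * (x ^ n)

  -- Polynomials over K: coefficient lists [a₀, a₁, …] meaning Σ aᵢ Xⁱ.
  Poly : Set c
  Poly = List Carrier

  coeff : Poly → ℕ → Carrier
  coeff []       _       = 0#
  coeff (a ∷ _)  zero    = a
  coeff (_ ∷ as) (suc i) = coeff as i

  _≈ₚ_ : Poly → Poly → Set ℓ
  p ≈ₚ q = ∀ i → coeff p i ≈ coeff q i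

  HasDegree : Poly → ℕ → Set ℓ
  HasDegree f n = ¬ (coeff f n ≈ 0#) × (∀ i → n ℕ.< i → coeff f i ≈ 0#)

  _+c_ : Carrier → Poly → Poly
  a +c []       = a ∷ []
  a +c (b ∷ p)  = (a + b) ∷ p

  shift : ℕ → Poly → Poly
  shift m p = replicate m 0# ++ p

  -- g(X^m)   (Horner: g(X^m) = g₀ + X^m · g'(X^m))
  compPow : Poly → ℕ → Poly
  compPow []      m = []
  compPow (a ∷ g) m = a +c shift m (compPow g m)

  scale : Carrier → Poly → Poly
  scale c []       = []
  scale c (a ∷ p)  = (c * a) ∷ scale c p

  -- p(yX): coefficient i becomes aᵢ yⁱ
  substLinFrom : Carrier → ℕ → Poly → Poly
  substLinFrom y i []       = []
  substLinFrom y i (a ∷ p)  = (a * (y ^ i)) ∷ substLinFrom y (suc i) p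

  substLin : Carrier → Poly → Poly
  substLin y p = substLinFrom y 0 p

IsFieldHom : ∀ {c ℓ c' ℓ'} (F : Field c ℓ) (L : Field c' ℓ') →
             (Field.Carrier F → Field.Carrier L) → Set _
IsFieldHom F L ι = IsRingHomomorphism (Field.rawRing F) (Field.rawRing L) ι

mapPoly : ∀ {a b} {A : Set a} {B : Set b} → (A → B) → List A → List B
mapPoly = List.map

HasCard : ∀ {c ℓ} (F : Field c ℓ) → ℕ → Set (c ⊔ ℓ)
HasCard F q = Σ (Fin q → Carrier) λ e →
                (∀ i j → e i ≈ e j → i ≡ j) × (∀ x → ∃ λ i → e i ≈ x)
  where open Field F

IsPrimePower : ℕ → Set
IsPrimePower q = ∃ λ p → ∃ λ r → Prime p × 1 ≤ r × q ≡ p ℕ.^ r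

open import Data.Nat.Divisibility using (_∣_)
open import Data.Nat.GCD using (gcd)

-- ζ generates the group of k-th roots of unity in L: ζ has multiplicative
-- order exactly k (ζ^k = 1 and ζ^i ≠ 1 for 0 < i < k).
IsPrimitiveRoot : ∀ {c ℓ} (L : Field c ℓ) → ℕ → Field.Carrier L → Set ℓ
IsPrimitiveRoot L k ζ =
  (ζ ^ k) ≈ 1# × (∀ i → 0 ℕ.< i → i ℕ.< k → ¬ ((ζ ^ i) ≈ 1#))
  where open Field L
        open FieldOps L

IsPolyInXPow : ∀ {c ℓ} (F : Field c ℓ) → FieldOps.Poly F → ℕ → Set (c ⊔ ℓ)
IsPolyInXPow F f m = ∃ λ g → f ≈ₚ compPow g m
  where open FieldOps F

IsMaxT : ∀ {c ℓ} (F : Field c ℓ) → FieldOps.Poly F → ℕ → ℕ → ℕ → Set (c ⊔ ℓ)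
IsMaxT F f n k t =
  (t ∣ gcd n k × IsPolyInXPow F f t) ×
  (∀ m → m ∣ gcd n k → IsPolyInXPow F f m → m ≤ t)

twist : ∀ {c ℓ c' ℓ'} (F : Field c ℓ) (L : Field c' ℓ') →
        (Field.Carrier F → Field.Carrier L) → Field.Carrier L →
        FieldOps.Poly F → ℕ → ℕ → FieldOps.Poly L
twist F L ι ζ f n j =
  scale ((ζ ^ (j ℕ.* n)) ⁻¹) (substLin (ζ ^ j) (mapPoly ι f))
  where open Field L
        open FieldOps L

{-# OPTIONS --safe #-}
-- The i-th coefficient of ζ^(-jn) f(ζ^j X) is aᵢ ζ^(-j(n-i)), so the twists for j and j′
-- agree iff k divides (j - j′)(n - i) for every i in the support of f. As a₀ ≠ 0 this
-- means k ∣ (j - j′) i on the support, i.e. f is a polynomial in X^m for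
-- m = k / gcd(k, j - j′), a divisor of gcd(n, k). Such admissible m are closed under lcm,
-- so m divides the maximal one, t, which is equivalent to k / t dividing j - j′.
-- Conversely, if k / t divides j - j′ then t divides n - i on the support.
module Submission where

open import Defs
open import Data.Empty using (⊥-elim)
open import Data.Fin.Properties as Fin using ()
open import Data.List using ([]; _∷_; length)
open import Data.Nat as ℕ using (ℕ; zero; suc; _≤_; _<_; _∸_; NonZero; z≤n; s≤s; ∣_-_∣)
import Data.Nat.Properties as ℕ
open import Data.Integer as ℤ using (+_)
import Data.Integer.Properties as ℤ
open import Data.Nat.Divisibility using (_∣_; _∣?_; divides; _∣0; ∣-refl; ∣-trans; ∣⇒≤; 0∣⇒≡0;
  ∣m∣n⇒∣m+n; ∣m+n∣m⇒∣n; *-pres-∣; *-cancelʳ-∣; m/n∣m; n∣m*n; m%n≡0⇒n∣m)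
open import Data.Nat.DivMod using (_/_; _%_; m/n*n≡m; m≡m%n+[m/n]*n; m%n<n)
open import Data.Nat.GCD using (gcd; gcd[m,n]∣m; gcd[m,n]∣n; gcd[m,n]≢0; gcd-greatest)
open import Data.Nat.LCM using (lcm; m∣lcm[m,n]; n∣lcm[m,n]; lcm-least)
open import Data.Nat.Coprimality using (coprime-divisor; coprime-/gcd)
open import Data.Nat.Tactic.RingSolver using (solve-∀)
open import Data.Product using (_,_; proj₁; proj₂)
open import Data.Sum using (inj₁; inj₂)
open import Function.Base using (_∘_)
open import Function.Bundles using (_⇔_; mk⇔; module Equivalence)
open import Function.Construct.Composition using (_⇔-∘_)
import Function.Related.Propositional as Related
import Relation.Binary.Reasoning.Setoid as ≈-Reasoning
open import Relation.Binary.Definitions using (Decidable)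
open import Relation.Binary.PropositionalEquality as ≡ using (_≡_)
open import Relation.Nullary using (¬_; yes; no)
open import Relation.Nullary.Decidable using (decidable-stable)
open import Algebra.Morphism.Structures using (module IsRingHomomorphism)

module FieldProperties {c ℓ} (K : Field c ℓ) where
  open Field K
  open FieldOps K
  open import Algebra.Properties.CommutativeSemigroup *-commutativeSemigroup
    public using (x∙yz≈y∙xz)
  open ≈-Reasoning setoid

  ≈-resp-⇔ : ∀ {x x′ y y′} → x ≈ x′ → y ≈ y′ → (x ≈ y) ⇔ (x′ ≈ y′)
  ≈-resp-⇔ x≈x′ y≈y′ =
    mk⇔ (λ x≈y → trans (sym x≈x′) (trans x≈y y≈y′))
        (λ x′≈y′ → trans x≈x′ (trans x′≈y′ (sym y≈y′)))

  *-⁻¹-cancelˡ : ∀ {x} y → ¬ x ≈ 0# → x * (x ⁻¹ * y) ≈ y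
  *-⁻¹-cancelˡ {x} y x≉0 = begin
    x * (x ⁻¹ * y)  ≈⟨ *-assoc x (x ⁻¹) y ⟨
    x * x ⁻¹ * y    ≈⟨ *-congʳ (⁻¹-inverse x x≉0) ⟩
    1# * y          ≈⟨ *-identityˡ y ⟩
    y               ∎

  ⁻¹-*-cancelˡ : ∀ {x} y → ¬ x ≈ 0# → x ⁻¹ * (x * y) ≈ y
  ⁻¹-*-cancelˡ {x} y x≉0 = trans (x∙yz≈y∙xz (x ⁻¹) x y) (*-⁻¹-cancelˡ y x≉0)

  *-cancelˡ : ∀ {x y z} → ¬ x ≈ 0# → x * y ≈ x * z → y ≈ z
  *-cancelˡ {x} {y} {z} x≉0 xy≈xz = begin
    y               ≈⟨ ⁻¹-*-cancelˡ y x≉0 ⟨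
    x ⁻¹ * (x * y)  ≈⟨ *-congˡ xy≈xz ⟩
    x ⁻¹ * (x * z)  ≈⟨ ⁻¹-*-cancelˡ z x≉0 ⟩
    z               ∎

  *-cancelˡ-⇔ : ∀ {x y z} → ¬ x ≈ 0# → (x * y ≈ x * z) ⇔ (y ≈ z)
  *-cancelˡ-⇔ x≉0 = mk⇔ (*-cancelˡ x≉0) *-congˡ

  *-≉0 : ∀ {x y} → ¬ x ≈ 0# → ¬ y ≈ 0# → ¬ x * y ≈ 0#
  *-≉0 {x} x≉0 y≉0 xy≈0 = y≉0 (*-cancelˡ x≉0 (trans xy≈0 (sym (zeroʳ x))))

  ⁻¹*≈⁻¹*⇔ : ∀ {x x′ y y′} → ¬ x ≈ 0# → ¬ x′ ≈ 0# →
             (x ⁻¹ * y ≈ x′ ⁻¹ * y′) ⇔ (x′ * y ≈ x * y′)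
  ⁻¹*≈⁻¹*⇔ {x} {x′} {y} {y′} x≉0 x′≉0 = mk⇔ to from
    where
    to : x ⁻¹ * y ≈ x′ ⁻¹ * y′ → x′ * y ≈ x * y′
    to eq = begin
      x′ * y                     ≈⟨ *-congˡ (*-⁻¹-cancelˡ y x≉0) ⟨
      x′ * (x * (x ⁻¹ * y))      ≈⟨ x∙yz≈y∙xz x′ x _ ⟩
      x * (x′ * (x ⁻¹ * y))      ≈⟨ *-congˡ (*-congˡ eq) ⟩
      x * (x′ * (x′ ⁻¹ * y′))    ≈⟨ *-congˡ (*-⁻¹-cancelˡ y′ x′≉0) ⟩
      x * y′                     ∎
    from : x′ * y ≈ x * y′ → x ⁻¹ * y ≈ x′ ⁻¹ * y′
    from eq = begin
      x ⁻¹ * y                   ≈⟨ *-congˡ (⁻¹-*-cancelˡ y x′≉0) ⟨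
      x ⁻¹ * (x′ ⁻¹ * (x′ * y))  ≈⟨ x∙yz≈y∙xz (x ⁻¹) (x′ ⁻¹) _ ⟩
      x′ ⁻¹ * (x ⁻¹ * (x′ * y))  ≈⟨ *-congˡ (*-congˡ eq) ⟩
      x′ ⁻¹ * (x ⁻¹ * (x * y′))  ≈⟨ *-congˡ (⁻¹-*-cancelˡ y′ x≉0) ⟩
      x′ ⁻¹ * y′                 ∎

  ^-congˡ : ∀ {x y} n → x ≈ y → x ^ n ≈ y ^ n
  ^-congˡ zero    x≈y = refl
  ^-congˡ (suc n) x≈y = *-cong x≈y (^-congˡ n x≈y)

  ^-homo-+ : ∀ x m n → x ^ (m ℕ.+ n) ≈ x ^ m * x ^ n
  ^-homo-+ x zero    n = sym (*-identityˡ (x ^ n))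
  ^-homo-+ x (suc m) n = trans (*-congˡ (^-homo-+ x m n)) (sym (*-assoc x (x ^ m) (x ^ n)))

  ^-assocʳ : ∀ x m n → (x ^ m) ^ n ≈ x ^ (m ℕ.* n)
  ^-assocʳ x m zero    = reflexive (≡.cong (x ^_) (≡.sym (ℕ.*-zeroʳ m)))
  ^-assocʳ x m (suc n) = begin
    x ^ m * (x ^ m) ^ n      ≈⟨ *-congˡ (^-assocʳ x m n) ⟩
    x ^ m * x ^ (m ℕ.* n)    ≈⟨ ^-homo-+ x m (m ℕ.* n) ⟨
    x ^ (m ℕ.+ m ℕ.* n)      ≡⟨ ≡.cong (x ^_) (ℕ.*-suc m n) ⟨
    x ^ (m ℕ.* suc n)        ∎

  1^n≈1 : ∀ n → 1# ^ n ≈ 1#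
  1^n≈1 zero    = refl
  1^n≈1 (suc n) = trans (*-identityˡ _) (1^n≈1 n)

  ^-≉0 : ∀ {x} n → ¬ x ≈ 0# → ¬ x ^ n ≈ 0#
  ^-≉0 zero    x≉0 1≈0 = 0≉1 (sym 1≈0)
  ^-≉0 (suc n) x≉0     = *-≉0 x≉0 (^-≉0 n x≉0)

  hasCard⇒≈-decidable : ∀ {q} → HasCard K q → Decidable _≈_
  hasCard⇒≈-decidable (enum , enum-injective , enum-surjective) x y
    with enum-surjective x | enum-surjective y
  ... | i , eᵢ≈x | j , eⱼ≈y with i Fin.≟ j
  ...   | yes ≡.refl = yes (trans (sym eᵢ≈x) eⱼ≈y)
  ...   | no i≢j     = no λ x≈y → i≢j (enum-injective i j (trans eᵢ≈x (trans x≈y (sym eⱼ≈y))))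

module PolyProperties {c ℓ} (K : Field c ℓ) where
  open Field K
  open FieldOps K

  coeff-scale : ∀ a p i → coeff (scale a p) i ≈ a * coeff p i
  coeff-scale a []      i       = sym (zeroʳ a)
  coeff-scale a (b ∷ p) zero    = refl
  coeff-scale a (b ∷ p) (suc i) = coeff-scale a p i

  coeff-substLinFrom : ∀ y b p i → coeff (substLinFrom y b p) i ≈ coeff p i * y ^ (b ℕ.+ i)
  coeff-substLinFrom y b []      i       = sym (zeroˡ _)
  coeff-substLinFrom y b (a ∷ p) zero    =
    reflexive (≡.cong (λ e → a * y ^ e) (≡.sym (ℕ.+-identityʳ b)))
  coeff-substLinFrom y b (a ∷ p) (suc i) = trans (coeff-substLinFrom y (suc b) p i)
    (reflexive (≡.cong (λ e → coeff p i * y ^ e) (≡.sym (ℕ.+-suc b i))))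

  coeff-substLin : ∀ y p i → coeff (substLin y p) i ≈ coeff p i * y ^ i
  coeff-substLin y = coeff-substLinFrom y 0

  coeff-≥length : ∀ p {i} → length p ≤ i → coeff p i ≡ 0#
  coeff-≥length []      _         = ≡.refl
  coeff-≥length (a ∷ p) (s≤s len≤i) = coeff-≥length p len≤i

  support≤degree : ∀ p {n i} → HasDegree p n → ¬ coeff p i ≈ 0# → i ≤ n
  support≤degree p {n} {i} (_ , vanishes) pᵢ≉0 with i ℕ.≤? n
  ... | yes i≤n = i≤n
  ... | no  i≰n = ⊥-elim (pᵢ≉0 (vanishes i (ℕ.≰⇒> i≰n)))

  fromCoeffs : (ℕ → Carrier) → ℕ → Poly
  fromCoeffs h zero    = []
  fromCoeffs h (suc N) = h 0 ∷ fromCoeffs (h ∘ suc) N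

  coeff-fromCoeffs-< : ∀ h N {r} → r < N → coeff (fromCoeffs h N) r ≡ h r
  coeff-fromCoeffs-< h (suc N) {zero}  _         = ≡.refl
  coeff-fromCoeffs-< h (suc N) {suc r} (s≤s r<N) = coeff-fromCoeffs-< (h ∘ suc) N r<N

  coeff-fromCoeffs-≥ : ∀ h N {r} → N ≤ r → coeff (fromCoeffs h N) r ≡ 0#
  coeff-fromCoeffs-≥ h zero    _         = ≡.refl
  coeff-fromCoeffs-≥ h (suc N) (s≤s N≤r) = coeff-fromCoeffs-≥ (h ∘ suc) N N≤r

  coeff-shift-< : ∀ m p {i} → i < m → coeff (shift m p) i ≈ 0#
  coeff-shift-< (suc m) p {zero}  _         = refl
  coeff-shift-< (suc m) p {suc i} (s≤s i<m) = coeff-shift-< m p i<m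

  coeff-shift-+ : ∀ m p i → coeff (shift m p) (m ℕ.+ i) ≡ coeff p i
  coeff-shift-+ zero    p i = ≡.refl
  coeff-shift-+ (suc m) p i = coeff-shift-+ m p i

  SupportedOnMultiplesOf : ℕ → Poly → Set ℓ
  SupportedOnMultiplesOf m p = ∀ i → ¬ m ∣ i → coeff p i ≈ 0#

  supportedOnMultiplesOf⇔ : Decidable _≈_ → ∀ m p →
    SupportedOnMultiplesOf m p ⇔ (∀ i → ¬ coeff p i ≈ 0# → m ∣ i)
  supportedOnMultiplesOf⇔ _≟_ m p = mk⇔
    (λ supp i pᵢ≉0 → decidable-stable (m ∣? i) (pᵢ≉0 ∘ supp i))
    (λ supp i m∤i → decidable-stable (coeff p i ≟ 0#) (m∤i ∘ supp i))

  coeff-compPow-* : ∀ g m .{{_ : NonZero m}} r → coeff (compPow g m) (r ℕ.* m) ≈ coeff g r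
  coeff-compPow-* []      m       r       = refl
  coeff-compPow-* (a ∷ g) (suc m) zero    = +-identityʳ a
  coeff-compPow-* (a ∷ g) (suc m) (suc r) =
    trans (reflexive (coeff-shift-+ m (compPow g (suc m)) (r ℕ.* suc m))) (coeff-compPow-* g (suc m) r)

  compPow-supported : ∀ g m .{{_ : NonZero m}} → SupportedOnMultiplesOf m (compPow g m)
  compPow-supported []      m       i       _   = refl
  compPow-supported (a ∷ g) (suc m) zero    m∤0 = ⊥-elim (m∤0 (suc m ∣0))
  compPow-supported (a ∷ g) (suc m) (suc i) m∤i with i ℕ.<? m
  ... | yes i<m = coeff-shift-< m (compPow g (suc m)) i<m
  ... | no  i≮m = begin
    coeff (shift m (compPow g (suc m))) i               ≡⟨ ≡.cong (coeff (shift m _)) i≡m+e ⟩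
    coeff (shift m (compPow g (suc m))) (m ℕ.+ (i ∸ m)) ≡⟨ coeff-shift-+ m _ (i ∸ m) ⟩
    coeff (compPow g (suc m)) (i ∸ m)                   ≈⟨ compPow-supported g (suc m) (i ∸ m) m∤e ⟩
    0#                                                  ∎
    where
    open ≈-Reasoning setoid
    i≡m+e : i ≡ m ℕ.+ (i ∸ m)
    i≡m+e = ≡.sym (ℕ.m+[n∸m]≡n (ℕ.≮⇒≥ i≮m))
    m∤e : ¬ suc m ∣ i ∸ m
    m∤e m∣e = m∤i (≡.subst (suc m ∣_) (≡.cong suc (≡.sym i≡m+e)) (∣m∣n⇒∣m+n ∣-refl m∣e))

  isPolyInXPow⇔supported : ∀ m .{{_ : NonZero m}} p →
    IsPolyInXPow K p m ⇔ SupportedOnMultiplesOf m p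
  isPolyInXPow⇔supported m p = mk⇔ supported supported⇒isPolyInXPow
    where
    supported : IsPolyInXPow K p m → SupportedOnMultiplesOf m p
    supported (g , p≈g[Xᵐ]) i m∤i = trans (p≈g[Xᵐ] i) (compPow-supported g m i m∤i)

    g : Poly
    g = fromCoeffs (λ r → coeff p (r ℕ.* m)) (length p)

    coeff-g : ∀ r → coeff g r ≈ coeff p (r ℕ.* m)
    coeff-g r with r ℕ.<? length p
    ... | yes r<len = reflexive (coeff-fromCoeffs-< _ (length p) r<len)
    ... | no  r≮len = reflexive (≡.trans (coeff-fromCoeffs-≥ _ (length p) len≤r)
                        (≡.sym (coeff-≥length p (ℕ.≤-trans len≤r (ℕ.m≤m*n r m)))))
      where len≤r = ℕ.≮⇒≥ r≮len

    supported⇒isPolyInXPow : SupportedOnMultiplesOf m p → IsPolyInXPow K p m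
    supported⇒isPolyInXPow supp = g , p≈g[Xᵐ]
      where
      p≈g[Xᵐ] : p ≈ₚ compPow g m
      p≈g[Xᵐ] i with m ∣? i
      ... | yes (divides r ≡.refl) = trans (sym (coeff-g r)) (sym (coeff-compPow-* g m r))
      ... | no  m∤i                = trans (supp i m∤i) (sym (compPow-supported g m i m∤i))

module FieldHomProperties {c ℓ c′ ℓ′} (F : Field c ℓ) (L : Field c′ ℓ′)
  {ι : Field.Carrier F → Field.Carrier L} (hom : IsFieldHom F L ι) where
  private module F = Field F
  open Field L
  open FieldOps L
  open IsRingHomomorphism hom
  open ≈-Reasoning setoid

  ι-≉0 : ∀ {x} → ¬ x F.≈ F.0# → ¬ ι x ≈ 0#
  ι-≉0 {x} x≉0 ιx≈0 = 0≉1 (begin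
    0#                ≈⟨ zeroˡ (ι (x F.⁻¹)) ⟨
    0# * ι (x F.⁻¹)   ≈⟨ *-congʳ ιx≈0 ⟨
    ι x * ι (x F.⁻¹)  ≈⟨ *-homo x (x F.⁻¹) ⟨
    ι (x F.* x F.⁻¹)  ≈⟨ ⟦⟧-cong (F.⁻¹-inverse x x≉0) ⟩
    ι F.1#            ≈⟨ 1#-homo ⟩
    1#                ∎)

  coeff-mapPoly : ∀ p i → coeff (mapPoly ι p) i ≈ ι (FieldOps.coeff F p i)
  coeff-mapPoly []      i       = sym 0#-homo
  coeff-mapPoly (a ∷ p) zero    = refl
  coeff-mapPoly (a ∷ p) (suc i) = coeff-mapPoly p i

module PrimitiveRootProperties {c ℓ} (K : Field c ℓ) (k : ℕ) .{{_ : NonZero k}}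
  {ζ : Field.Carrier K} (prim : IsPrimitiveRoot K k ζ) where
  open Field K
  open FieldOps K
  open FieldProperties K

  ζ≉0 : ¬ ζ ≈ 0#
  ζ≉0 ζ≈0 = 0≉1 (begin
    0#                  ≈⟨ zeroˡ (ζ ^ ℕ.pred k) ⟨
    0# * ζ ^ ℕ.pred k   ≈⟨ *-congʳ ζ≈0 ⟨
    ζ ^ suc (ℕ.pred k)  ≡⟨ ≡.cong (ζ ^_) (ℕ.suc-pred k) ⟩
    ζ ^ k               ≈⟨ proj₁ prim ⟩
    1#                  ∎)
    where open ≈-Reasoning setoid

  ∣⇒^≈1 : ∀ {x} → k ∣ x → ζ ^ x ≈ 1#
  ∣⇒^≈1 (divides q ≡.refl) = begin
    ζ ^ (q ℕ.* k)  ≡⟨ ≡.cong (ζ ^_) (ℕ.*-comm q k) ⟩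
    ζ ^ (k ℕ.* q)  ≈⟨ ^-assocʳ ζ k q ⟨
    (ζ ^ k) ^ q    ≈⟨ ^-congˡ q (proj₁ prim) ⟩
    1# ^ q         ≈⟨ 1^n≈1 q ⟩
    1#             ∎
    where open ≈-Reasoning setoid

  ^≈^-% : ∀ x → ζ ^ x ≈ ζ ^ (x % k)
  ^≈^-% x = begin
    ζ ^ x                              ≡⟨ ≡.cong (ζ ^_) (m≡m%n+[m/n]*n x k) ⟩
    ζ ^ (x % k ℕ.+ x / k ℕ.* k)        ≈⟨ ^-homo-+ ζ (x % k) (x / k ℕ.* k) ⟩
    ζ ^ (x % k) * ζ ^ (x / k ℕ.* k)    ≈⟨ *-congˡ (∣⇒^≈1 (n∣m*n (x / k))) ⟩
    ζ ^ (x % k) * 1#                   ≈⟨ *-identityʳ _ ⟩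
    ζ ^ (x % k)                        ∎
    where open ≈-Reasoning setoid

  ^≈1⇒≡0 : ∀ r → r < k → ζ ^ r ≈ 1# → r ≡ 0
  ^≈1⇒≡0 zero    _   _      = ≡.refl
  ^≈1⇒≡0 (suc r) r<k ζʳ≈1 = ⊥-elim (proj₂ prim (suc r) (s≤s z≤n) r<k ζʳ≈1)

  ^≈1⇔∣ : ∀ x → (ζ ^ x ≈ 1#) ⇔ (k ∣ x)
  ^≈1⇔∣ x = mk⇔
    (λ ζˣ≈1 → m%n≡0⇒n∣m x k (^≈1⇒≡0 (x % k) (m%n<n x k) (trans (sym (^≈^-% x)) ζˣ≈1)))
    ∣⇒^≈1

  ^≈^+⇔∣ : ∀ a d → (ζ ^ a ≈ ζ ^ (a ℕ.+ d)) ⇔ (k ∣ d)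
  ^≈^+⇔∣ a d = begin
    ζ ^ a ≈ ζ ^ (a ℕ.+ d)        ∼⟨ ≈-resp-⇔ (sym (*-identityʳ _)) (^-homo-+ ζ a d) ⟩
    ζ ^ a * 1# ≈ ζ ^ a * ζ ^ d   ∼⟨ *-cancelˡ-⇔ (^-≉0 a ζ≉0) ⟩
    1# ≈ ζ ^ d                   ∼⟨ mk⇔ sym sym ⟩
    ζ ^ d ≈ 1#                   ∼⟨ ^≈1⇔∣ d ⟩
    k ∣ d                        ∎
    where open Related.EquationalReasoning

  ≤⇒^≈^⇔∣∣-∣ : ∀ {a b} → a ≤ b → (ζ ^ a ≈ ζ ^ b) ⇔ (k ∣ ∣ a - b ∣)
  ≤⇒^≈^⇔∣∣-∣ {a} {b} a≤b with b ∸ a | ℕ.m+[n∸m]≡n a≤b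
  ... | d | ≡.refl rewrite ℕ.∣m-m+n∣≡n a d = ^≈^+⇔∣ a d

  ^≈^⇔∣∣-∣ : ∀ a b → (ζ ^ a ≈ ζ ^ b) ⇔ (k ∣ ∣ a - b ∣)
  ^≈^⇔∣∣-∣ a b with ℕ.≤-total a b
  ... | inj₁ a≤b = ≤⇒^≈^⇔∣∣-∣ a≤b
  ... | inj₂ b≤a = ≡.subst (λ d → (ζ ^ a ≈ ζ ^ b) ⇔ (k ∣ d)) (ℕ.∣-∣-comm b a)
                     (≤⇒^≈^⇔∣∣-∣ b≤a ⇔-∘ mk⇔ sym sym)

∣*⇔/gcd∣ : ∀ k d x .{{_ : NonZero (gcd k d)}} → (k ∣ d ℕ.* x) ⇔ (k / gcd k d ∣ x)
∣*⇔/gcd∣ k d x = mk⇔ to from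
  where
  g = gcd k d
  k/g*g≡k : k / g ℕ.* g ≡ k
  k/g*g≡k = m/n*n≡m (gcd[m,n]∣m k d)
  d/g*g≡d : d / g ℕ.* g ≡ d
  d/g*g≡d = m/n*n≡m (gcd[m,n]∣n k d)
  xy*z≡xz*y : ∀ x y z → x ℕ.* y ℕ.* z ≡ x ℕ.* z ℕ.* y
  xy*z≡xz*y = solve-∀

  to : k ∣ d ℕ.* x → k / g ∣ x
  to k∣dx = coprime-divisor (coprime-/gcd k d)
    (*-cancelʳ-∣ g (≡.subst₂ _∣_ (≡.sym k/g*g≡k) dx≡ k∣dx))
    where
    dx≡ : d ℕ.* x ≡ d / g ℕ.* x ℕ.* g
    dx≡ = ≡.trans (≡.cong (ℕ._* x) (≡.sym d/g*g≡d)) (xy*z≡xz*y (d / g) g x)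

  from : k / g ∣ x → k ∣ d ℕ.* x
  from k/g∣x = ≡.subst₂ _∣_ k/g*g≡k (ℕ.*-comm x d) (*-pres-∣ k/g∣x (gcd[m,n]∣n k d))

∣bn+ai-an+bi∣≡∣a-b∣*[n∸i] : ∀ a b {i n} → i ≤ n →
  ∣ b ℕ.* n ℕ.+ a ℕ.* i - a ℕ.* n ℕ.+ b ℕ.* i ∣ ≡ ∣ a - b ∣ ℕ.* (n ∸ i)
∣bn+ai-an+bi∣≡∣a-b∣*[n∸i] a b {i} {n} i≤n = begin
  ∣ b ℕ.* n ℕ.+ a ℕ.* i - a ℕ.* n ℕ.+ b ℕ.* i ∣
    ≡⟨ ≡.cong (λ n → ∣ b ℕ.* n ℕ.+ a ℕ.* i - a ℕ.* n ℕ.+ b ℕ.* i ∣) (≡.sym (ℕ.m+[n∸m]≡n i≤n)) ⟩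
  ∣ b ℕ.* (i ℕ.+ e) ℕ.+ a ℕ.* i - a ℕ.* (i ℕ.+ e) ℕ.+ b ℕ.* i ∣
    ≡⟨ ≡.cong₂ ∣_-_∣ (split b a i e)
         (≡.trans (split a b i e) (≡.cong (ℕ._+ a ℕ.* e) (ℕ.+-comm (b ℕ.* i) (a ℕ.* i)))) ⟩
  ∣ (a ℕ.* i ℕ.+ b ℕ.* i) ℕ.+ b ℕ.* e - (a ℕ.* i ℕ.+ b ℕ.* i) ℕ.+ a ℕ.* e ∣
    ≡⟨ ℕ.∣m+n-m+o∣≡∣n-o∣ (a ℕ.* i ℕ.+ b ℕ.* i) (b ℕ.* e) (a ℕ.* e) ⟩
  ∣ b ℕ.* e - a ℕ.* e ∣
    ≡⟨ ℕ.*-distribʳ-∣-∣ e b a ⟨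
  ∣ b - a ∣ ℕ.* e
    ≡⟨ ≡.cong (ℕ._* e) (ℕ.∣-∣-comm b a) ⟩
  ∣ a - b ∣ ℕ.* e ∎
  where
  open ≡.≡-Reasoning
  e = n ∸ i
  split : ∀ x y i e → x ℕ.* (i ℕ.+ e) ℕ.+ y ℕ.* i ≡ (y ℕ.* i ℕ.+ x ℕ.* i) ℕ.+ x ℕ.* e
  split = solve-∀

module MaximalPeriod {c ℓ} (F : Field c ℓ) (_≟_ : Decidable (Field._≈_ F))
  (f : FieldOps.Poly F) (n : ℕ) (deg : FieldOps.HasDegree F f n)
  (f₀≉0 : ¬ Field._≈_ F (FieldOps.coeff F f 0) (Field.0# F))
  (k : ℕ) .{{_ : NonZero k}} (t : ℕ) (maxT : IsMaxT F f n k t) where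
  open Field F
  open FieldOps F
  open PolyProperties F
  open Equivalence using (to; from)

  ∣gcd[n,k]⇒nonZero : ∀ {m} → m ∣ gcd n k → NonZero m
  ∣gcd[n,k]⇒nonZero {m} m∣g = ℕ.≢-nonZero λ m≡0 →
    gcd[m,n]≢0 n k (inj₂ (ℕ.≢-nonZero⁻¹ k)) (0∣⇒≡0 (≡.subst (_∣ gcd n k) m≡0 m∣g))

  t∣gcd[n,k] : t ∣ gcd n k
  t∣gcd[n,k] = proj₁ (proj₁ maxT)

  instance
    t-nonZero : NonZero t
    t-nonZero = ∣gcd[n,k]⇒nonZero t∣gcd[n,k]

  support≤n : ∀ {i} → ¬ coeff f i ≈ 0# → i ≤ n
  support≤n = support≤degree f deg

  t∣n : t ∣ n
  t∣n = ∣-trans t∣gcd[n,k] (gcd[m,n]∣m n k)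

  f-supported-t : SupportedOnMultiplesOf t f
  f-supported-t = to (isPolyInXPow⇔supported t f) (proj₂ (proj₁ maxT))

  -- The admissible periods are closed under lcm, so the maximal one is a multiple of all of them.
  ∣t : ∀ {m} → m ∣ gcd n k → SupportedOnMultiplesOf m f → m ∣ t
  ∣t {m} m∣g f-supported-m = ≡.subst (m ∣_) lcm≡t (m∣lcm[m,n] m t)
    where
    l∣g : lcm m t ∣ gcd n k
    l∣g = lcm-least m∣g t∣gcd[n,k]
    instance
      l-nonZero : NonZero (lcm m t)
      l-nonZero = ∣gcd[n,k]⇒nonZero l∣g
    f-supported-l : SupportedOnMultiplesOf (lcm m t) f
    f-supported-l i l∤i with m ∣? i | t ∣? i
    ... | yes m∣i | yes t∣i = ⊥-elim (l∤i (lcm-least m∣i t∣i))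
    ... | no  m∤i | _       = f-supported-m i m∤i
    ... | _       | no  t∤i = f-supported-t i t∤i
    lcm≡t : lcm m t ≡ t
    lcm≡t = ℕ.≤-antisym
      (proj₂ maxT (lcm m t) l∣g (from (isPolyInXPow⇔supported (lcm m t) f) f-supported-l))
      (∣⇒≤ (n∣lcm[m,n] m t))

  ∣*[n∸i]⇔∣ : ∀ {s} d → s ℕ.* t ≡ k →
    (∀ i → ¬ coeff f i ≈ 0# → k ∣ d ℕ.* (n ∸ i)) ⇔ (s ∣ d)
  ∣*[n∸i]⇔∣ {s} d st≡k = mk⇔ ∣d ∣*[n∸i]
    where
    ∣*[n∸i] : s ∣ d → ∀ i → ¬ coeff f i ≈ 0# → k ∣ d ℕ.* (n ∸ i)
    ∣*[n∸i] s∣d i fᵢ≉0 = ≡.subst (_∣ d ℕ.* (n ∸ i)) st≡k (*-pres-∣ s∣d t∣n∸i)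
      where
      t∣i : t ∣ i
      t∣i = to (supportedOnMultiplesOf⇔ _≟_ t f) f-supported-t i fᵢ≉0
      t∣n∸i : t ∣ n ∸ i
      t∣n∸i = ∣m+n∣m⇒∣n (≡.subst (t ∣_) (≡.sym (ℕ.m+[n∸m]≡n (support≤n fᵢ≉0))) t∣n) t∣i

    -- k ∣ d * i on the support says that m = k / gcd k d divides the support, so m ∣ t.
    ∣d : (∀ i → ¬ coeff f i ≈ 0# → k ∣ d ℕ.* (n ∸ i)) → s ∣ d
    ∣d k∣d[n∸i] = *-cancelʳ-∣ t
      (≡.subst (_∣ d ℕ.* t) (≡.sym st≡k) (from (∣*⇔/gcd∣ k d t) (∣t m∣gcd f-supported-m)))
      where
      instance
        gcd[k,d]-nonZero : NonZero (gcd k d)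
        gcd[k,d]-nonZero = ℕ.≢-nonZero (gcd[m,n]≢0 k d (inj₁ (ℕ.≢-nonZero⁻¹ k)))
      m = k / gcd k d
      k∣dn : k ∣ d ℕ.* n
      k∣dn = k∣d[n∸i] 0 f₀≉0
      k∣di : ∀ i → ¬ coeff f i ≈ 0# → k ∣ d ℕ.* i
      k∣di i fᵢ≉0 = ∣m+n∣m⇒∣n (≡.subst (k ∣_) dn≡ k∣dn) (k∣d[n∸i] i fᵢ≉0)
        where
        dn≡ : d ℕ.* n ≡ d ℕ.* (n ∸ i) ℕ.+ d ℕ.* i
        dn≡ = ≡.trans (≡.cong (d ℕ.*_) (≡.sym (ℕ.m∸n+n≡m (support≤n fᵢ≉0))))
                      (ℕ.*-distribˡ-+ d (n ∸ i) i)
      m∣gcd : m ∣ gcd n k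
      m∣gcd = gcd-greatest (to (∣*⇔/gcd∣ k d n) k∣dn) (m/n∣m (gcd[m,n]∣m k d))
      f-supported-m : SupportedOnMultiplesOf m f
      f-supported-m = from (supportedOnMultiplesOf⇔ _≟_ m f)
        λ i fᵢ≉0 → to (∣*⇔/gcd∣ k d i) (k∣di i fᵢ≉0)

module TwistProperties {c ℓ c′ ℓ′} (F : Field c ℓ) (L : Field c′ ℓ′)
  {ι : Field.Carrier F → Field.Carrier L} (hom : IsFieldHom F L ι)
  (k : ℕ) .{{_ : NonZero k}} {ζ : Field.Carrier L} (prim : IsPrimitiveRoot L k ζ)
  (f : FieldOps.Poly F) (n : ℕ) where
  private module F = Field F
  open Field L
  open FieldOps L
  open FieldProperties L
  open PolyProperties L
  open FieldHomProperties F L hom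
  open PrimitiveRootProperties L k prim

  private
    a : ℕ → F.Carrier
    a = FieldOps.coeff F f

    twistⱼ : ℕ → Poly
    twistⱼ = twist F L ι ζ f n

  coeff-twist : ∀ j i → coeff (twistⱼ j) i ≈ (ζ ^ (j ℕ.* n)) ⁻¹ * (ι (a i) * ζ ^ (j ℕ.* i))
  coeff-twist j i = begin
    coeff (twistⱼ j) i
      ≈⟨ coeff-scale (w ⁻¹) (substLin (ζ ^ j) (mapPoly ι f)) i ⟩
    w ⁻¹ * coeff (substLin (ζ ^ j) (mapPoly ι f)) i
      ≈⟨ *-congˡ (coeff-substLin (ζ ^ j) (mapPoly ι f) i) ⟩
    w ⁻¹ * (coeff (mapPoly ι f) i * (ζ ^ j) ^ i)
      ≈⟨ *-congˡ (*-cong (coeff-mapPoly f i) (^-assocʳ ζ j i)) ⟩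
    w ⁻¹ * (ι (a i) * ζ ^ (j ℕ.* i))
      ∎
    where
    open ≈-Reasoning setoid
    w = ζ ^ (j ℕ.* n)

  coeff-twist-≈0 : ∀ j {i} → a i F.≈ F.0# → coeff (twistⱼ j) i ≈ 0#
  coeff-twist-≈0 j {i} aᵢ≈0 = begin
    coeff (twistⱼ j) i          ≈⟨ coeff-twist j i ⟩
    w ⁻¹ * (ι (a i) * z)        ≈⟨ *-congˡ (*-congʳ (trans (⟦⟧-cong aᵢ≈0) 0#-homo)) ⟩
    w ⁻¹ * (0# * z)             ≈⟨ *-congˡ (zeroˡ z) ⟩
    w ⁻¹ * 0#                   ≈⟨ zeroʳ (w ⁻¹) ⟩
    0#                          ∎
    where
    open ≈-Reasoning setoid
    open IsRingHomomorphism hom using (⟦⟧-cong; 0#-homo)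
    w = ζ ^ (j ℕ.* n)
    z = ζ ^ (j ℕ.* i)

  coeff-twist≈⇔ : ∀ j j′ {i} → ¬ a i F.≈ F.0# → i ≤ n →
    (coeff (twistⱼ j) i ≈ coeff (twistⱼ j′) i) ⇔ (k ∣ ∣ j - j′ ∣ ℕ.* (n ∸ i))
  coeff-twist≈⇔ j j′ {i} aᵢ≉0 i≤n = begin
    coeff (twistⱼ j) i ≈ coeff (twistⱼ j′) i
      ∼⟨ ≈-resp-⇔ (coeff-twist j i) (coeff-twist j′ i) ⟩
    w ⁻¹ * (A * z) ≈ w′ ⁻¹ * (A * z′)
      ∼⟨ ⁻¹*≈⁻¹*⇔ (^-≉0 (j ℕ.* n) ζ≉0) (^-≉0 (j′ ℕ.* n) ζ≉0) ⟩
    w′ * (A * z) ≈ w * (A * z′)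
      ∼⟨ ≈-resp-⇔ (x∙yz≈y∙xz w′ A z) (x∙yz≈y∙xz w A z′) ⟩
    A * (w′ * z) ≈ A * (w * z′)
      ∼⟨ *-cancelˡ-⇔ (ι-≉0 aᵢ≉0) ⟩
    w′ * z ≈ w * z′
      ∼⟨ ≈-resp-⇔ (sym (^-homo-+ ζ (j′ ℕ.* n) (j ℕ.* i))) (sym (^-homo-+ ζ (j ℕ.* n) (j′ ℕ.* i))) ⟩
    ζ ^ (j′ ℕ.* n ℕ.+ j ℕ.* i) ≈ ζ ^ (j ℕ.* n ℕ.+ j′ ℕ.* i)
      ∼⟨ ^≈^⇔∣∣-∣ (j′ ℕ.* n ℕ.+ j ℕ.* i) (j ℕ.* n ℕ.+ j′ ℕ.* i) ⟩
    k ∣ ∣ j′ ℕ.* n ℕ.+ j ℕ.* i - j ℕ.* n ℕ.+ j′ ℕ.* i ∣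
      ≡⟨ ≡.cong (k ∣_) (∣bn+ai-an+bi∣≡∣a-b∣*[n∸i] j j′ i≤n) ⟩
    k ∣ ∣ j - j′ ∣ ℕ.* (n ∸ i)
      ∎
    where
    open Related.EquationalReasoning
    A = ι (a i)
    w = ζ ^ (j ℕ.* n)
    w′ = ζ ^ (j′ ℕ.* n)
    z = ζ ^ (j ℕ.* i)
    z′ = ζ ^ (j′ ℕ.* i)

  twist≈ₚ⇔ : Decidable F._≈_ → FieldOps.HasDegree F f n → ∀ j j′ →
    (twistⱼ j ≈ₚ twistⱼ j′) ⇔ (∀ i → ¬ a i F.≈ F.0# → k ∣ ∣ j - j′ ∣ ℕ.* (n ∸ i))
  twist≈ₚ⇔ _≟_ deg j j′ = mk⇔
    (λ twists≈ i aᵢ≉0 → Equivalence.to (coeff-twist≈⇔ j j′ aᵢ≉0 (support≤n aᵢ≉0)) (twists≈ i))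
    coeffs≈
    where
    support≤n : ∀ {i} → ¬ a i F.≈ F.0# → i ≤ n
    support≤n = PolyProperties.support≤degree F f deg
    coeffs≈ : (∀ i → ¬ a i F.≈ F.0# → k ∣ ∣ j - j′ ∣ ℕ.* (n ∸ i)) → twistⱼ j ≈ₚ twistⱼ j′
    coeffs≈ k∣ i with a i ≟ F.0#
    ... | yes aᵢ≈0 = trans (coeff-twist-≈0 j aᵢ≈0) (sym (coeff-twist-≈0 j′ aᵢ≈0))
    ... | no  aᵢ≉0 = Equivalence.from (coeff-twist≈⇔ j j′ aᵢ≉0 (support≤n aᵢ≉0)) (k∣ i aᵢ≉0)

∣+m-+n∣≡∣m-n∣ : ∀ m n → ℤ.∣ + m ℤ.- + n ∣ ≡ ∣ m - n ∣
∣+m-+n∣≡∣m-n∣ m n with ℕ.≤-total m n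
... | inj₁ m≤n = ≡.trans (≡.cong ℤ.∣_∣ (ℤ.m-n≡m⊖n m n))
                   (≡.trans (ℤ.∣⊖∣-≤ m≤n) (≡.sym (ℕ.m≤n⇒∣m-n∣≡n∸m m≤n)))
... | inj₂ n≤m = ≡.trans (≡.cong ℤ.∣_∣ (ℤ.m-n≡m⊖n m n))
                   (≡.trans (ℤ.∣m⊖n∣≡∣n⊖m∣ m n)
                   (≡.trans (ℤ.∣⊖∣-≤ n≤m) (≡.sym (ℕ.m≤n⇒∣n-m∣≡n∸m n≤m))))

open import Data.Nat using (ℕ; _<_; _*_)
open import Data.Nat.GCD using (gcd)
open import Data.Integer using (+_; _-_)
open import Data.Integer.Divisibility using () renaming (_∣_ to _∣ℤ_)
open import Relation.Binary.PropositionalEquality using (_≡_)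
open import Relation.Nullary using (¬_)
open import Function.Bundles using (_⇔_)

-- That q is a prime power coprime to k only guarantees that ζ exists; of HasCard the proof
-- uses just that it makes equality in F decidable. Likewise j < k only serves to make k
-- nonzero: the equivalence holds for all j and j′.
theorem6 : ∀ {c ℓ c' ℓ'} (F : Field c ℓ) (L : Field c' ℓ')
    (q : ℕ) → IsPrimePower q → HasCard F q →
    (k : ℕ) → gcd k q ≡ 1 →
    (ι : Field.Carrier F → Field.Carrier L) → IsFieldHom F L ι →
    (ζ : Field.Carrier L) → IsPrimitiveRoot L k ζ →
    (f : FieldOps.Poly F) (n : ℕ) → FieldOps.HasDegree F f n →
    ¬ (Field._≈_ F (FieldOps.coeff F f 0) (Field.0# F)) →
    (t : ℕ) → IsMaxT F f n k t →
    (s : ℕ) → s * t ≡ k →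
    (j j′ : ℕ) → j < k → j′ < k →
    FieldOps._≈ₚ_ L (twist F L ι ζ f n j) (twist F L ι ζ f n j′)
      ⇔ (+ s ∣ℤ (+ j - + j′))
theorem6 F L _ _ card k _ ι hom ζ prim f n deg f₀≉0 t maxT s st j j′ j<k _ = begin
  twist F L ι ζ f n j ≈ₚ twist F L ι ζ f n j′
    ∼⟨ twist≈ₚ⇔ _≟_ deg j j′ ⟩
  (∀ i → ¬ coeff f i ≈ 0# → k ∣ ∣ j - j′ ∣ * (n ∸ i))
    ∼⟨ ∣*[n∸i]⇔∣ ∣ j - j′ ∣ st ⟩
  s ∣ ∣ j - j′ ∣
    ≡⟨ ≡.cong (s ∣_) (∣+m-+n∣≡∣m-n∣ j j′) ⟨
  + s ∣ℤ (+ j - + j′)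
    ∎
  where
  open Related.EquationalReasoning
  open Field F using (_≈_; 0#)
  open FieldOps F using (coeff)
  open FieldOps L using (_≈ₚ_)
  instance
    k-nonZero : NonZero k
    k-nonZero = ℕ.>-nonZero (ℕ.≤-<-trans z≤n j<k)
  _≟_ : Decidable _≈_
  _≟_ = FieldProperties.hasCard⇒≈-decidable F card
  open TwistProperties F L hom k prim f n
  open MaximalPeriod F _≟_ f n deg f₀≉0 k t maxT
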